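{- For every integer $n\ge2$ and all integers $m_{1}, \dots, m_{n} \geq 0$, \[ (m_{1},m_{2}, \dots, m_{n-1};m_{n})_{2} =(m_{1};m_{2} +\cdots+m_{n})_{2}\cdots(m_{n-2};m_{n-1}+m_{n})_{2}(m_{n-1};m_{n})_{2}. \]
   Context: Tableaux of the second kind: a shape is a sequence of columns $1,\dots,n$ from left to right with heights $m_1,\dots,m_n\ge0$. A tableau of this shape fills each position with a nonnegative integer such that (i) entries weakly increase going down each column, and (ii) every entry in column $i$ is at most $m_{i+1}+\cdots+m_n$ (the total number of entries in the columns to its right). Define $(m_1,\dots,m_{n-1};m_n)_2=\sum_{T}\prod_{e}e$, where $T$ runs over all tableaux of shape $(m_1,\dots,m_n)$ and the product runs over the entries $e$ of $T$ lying in columns $1,\dots,n-1$ (empty product $=1$). In particular $(a;b)_2$ is this quantity for the two-column shape $(a,b)$. -}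

module Defs where

open import Data.Nat using (ℕ; zero; suc; _+_; _*_; _∸_)
open import Data.List using (List; []; _∷_; [_]; map; concatMap; upTo)
open import Data.Nat.ListAction using (sum; product)

-- Integers lo, lo+1, ..., B (empty if B < lo).
range : ℕ → ℕ → List ℕ
range lo B = map (lo +_) (upTo (suc B ∸ lo))

incSeqs : ℕ → ℕ → ℕ → List (List ℕ)
incSeqs zero    lo B = [ [] ]
incSeqs (suc k) lo B = concatMap (λ x → map (x ∷_) (incSeqs k x B)) (range lo B)

-- All tableaux of the second kind of shape (m₁,…,mₙ): a tableau is a list of
-- columns (top to bottom), column i weakly increasing with entries in
-- [0, m_{i+1}+⋯+m_n].
tableaux : List ℕ → List (List (List ℕ))
tableaux []       = [ [] ]
tableaux (m ∷ ms) = concatMap (λ c → map (c ∷_) (tableaux ms)) (incSeqs m 0 (sum ms))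

weight : List (List ℕ) → ℕ
weight []               = 1
weight (c ∷ [])         = 1
weight (c ∷ cs@(_ ∷ _)) = product c * weight cs

T₂ : List ℕ → ℕ
T₂ ms = sum (map weight (tableaux ms))

pair₂ : ℕ → ℕ → ℕ
pair₂ a b = T₂ (a ∷ b ∷ [])

rhsProd : List ℕ → ℕ
rhsProd []                = 1
rhsProd (a ∷ [])          = 1
rhsProd (a ∷ rest@(_ ∷ _)) = pair₂ a (sum rest) * rhsProd rest

-- A tableau of shape (a, m₂, …, mₙ) is an arbitrary column of height a with
-- entries in [0, m₂ + ⋯ + mₙ] placed in front of an arbitrary tableau of shape
-- (m₂, …, mₙ), and the weight of the pair is the product of the two weights.
-- Summing over this cartesian product factors T₂ as (a; m₂ + ⋯ + mₙ)₂ times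
-- the T₂ of the shorter shape; a one-column shape has the single all-zero
-- tableau, of weight 1. Induction on the number of columns finishes the proof.
module Submission where

open import Defs
open import Data.Nat using (ℕ; _≤_; zero; suc; _+_; _*_)
open import Data.Nat.Properties using (*-distribˡ-+; *-distribʳ-+; *-zeroʳ; *-identityʳ; +-identityʳ)
open import Data.Nat.ListAction using (sum; product)
open import Data.Nat.ListAction.Properties using (sum-++)
open import Data.List using (List; []; _∷_; [_]; _++_; map; concatMap; replicate)
open import Data.List.Properties using (map-∘; map-cong; map-concatMap; concatMap-cong)
open import Data.Vec using (Vec; toList)
open import Function using (_∘_)
open import Relation.Binary.PropositionalEquality using (_≡_; refl; cong; cong₂; sym; trans)
open Relation.Binary.PropositionalEquality.≡-Reasoning

private
  variable
    A : Set

sum-concatMap : (f : A → List ℕ) (xs : List A) →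
  sum (concatMap f xs) ≡ sum (map (sum ∘ f) xs)
sum-concatMap f []       = refl
sum-concatMap f (x ∷ xs) =
  trans (sum-++ (f x) (concatMap f xs)) (cong (sum (f x) +_) (sum-concatMap f xs))

sum-map-*ˡ : (k : ℕ) (f : A → ℕ) (xs : List A) →
  sum (map (λ x → k * f x) xs) ≡ k * sum (map f xs)
sum-map-*ˡ k f []       = sym (*-zeroʳ k)
sum-map-*ˡ k f (x ∷ xs) =
  trans (cong (k * f x +_) (sum-map-*ˡ k f xs)) (sym (*-distribˡ-+ k (f x) _))

sum-map-*ʳ : (f : A → ℕ) (k : ℕ) (xs : List A) →
  sum (map (λ x → f x * k) xs) ≡ sum (map f xs) * k
sum-map-*ʳ f k []       = refl
sum-map-*ʳ f k (x ∷ xs) =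
  trans (cong (f x * k +_) (sum-map-*ʳ f k xs)) (sym (*-distribʳ-+ k (f x) _))

columnSum : ℕ → ℕ → ℕ
columnSum a B = sum (map product (incSeqs a 0 B))

incSeqs-zero : ∀ k → incSeqs k 0 0 ≡ [ replicate k 0 ]
incSeqs-zero zero    = refl
incSeqs-zero (suc k) = cong (λ cs → map (0 ∷_) cs ++ []) (incSeqs-zero k)

T₂-[_] : ∀ m → T₂ (m ∷ []) ≡ 1
T₂-[ m ] rewrite incSeqs-zero m = refl

-- Weight is multiplicative only in front of a nonempty tableau, which every
-- tableau of a nonempty shape is.
map-weight-∷ : ∀ c x xs →
  map (weight ∘ (c ∷_)) (tableaux (x ∷ xs)) ≡ map (λ t → product c * weight t) (tableaux (x ∷ xs))
map-weight-∷ c x xs = begin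
    map (weight ∘ (c ∷_)) (concatMap (λ d → map (d ∷_) R) D)
  ≡⟨ map-concatMap (weight ∘ (c ∷_)) (λ d → map (d ∷_) R) D ⟩
    concatMap (λ d → map (weight ∘ (c ∷_)) (map (d ∷_) R)) D
  ≡⟨ concatMap-cong (λ d → trans (sym (map-∘ R)) (map-∘ R)) D ⟩
    concatMap (λ d → map (λ t → product c * weight t) (map (d ∷_) R)) D
  ≡⟨ map-concatMap (λ t → product c * weight t) (λ d → map (d ∷_) R) D ⟨
    map (λ t → product c * weight t) (concatMap (λ d → map (d ∷_) R) D)
  ∎
  where
  D = incSeqs x 0 (sum xs)
  R = tableaux xs

T₂-∷-∷ : ∀ a x xs → T₂ (a ∷ x ∷ xs) ≡ columnSum a (x + sum xs) * T₂ (x ∷ xs)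
T₂-∷-∷ a x xs = begin
    sum (map weight (concatMap (λ c → map (c ∷_) Ts) C))
  ≡⟨ cong sum (map-concatMap weight (λ c → map (c ∷_) Ts) C) ⟩
    sum (concatMap (λ c → map weight (map (c ∷_) Ts)) C)
  ≡⟨ sum-concatMap (λ c → map weight (map (c ∷_) Ts)) C ⟩
    sum (map (λ c → sum (map weight (map (c ∷_) Ts))) C)
  ≡⟨ cong sum (map-cong prepend C) ⟩
    sum (map (λ c → product c * T₂ (x ∷ xs)) C)
  ≡⟨ sum-map-*ʳ product (T₂ (x ∷ xs)) C ⟩
    columnSum a (x + sum xs) * T₂ (x ∷ xs)
  ∎
  where
  C  = incSeqs a 0 (x + sum xs)
  Ts = tableaux (x ∷ xs)

  prepend : ∀ c → sum (map weight (map (c ∷_) Ts)) ≡ product c * T₂ (x ∷ xs)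
  prepend c = begin
      sum (map weight (map (c ∷_) Ts))
    ≡⟨ cong sum (map-∘ Ts) ⟨
      sum (map (weight ∘ (c ∷_)) Ts)
    ≡⟨ cong sum (map-weight-∷ c x xs) ⟩
      sum (map (λ t → product c * weight t) Ts)
    ≡⟨ sum-map-*ˡ (product c) weight Ts ⟩
      product c * T₂ (x ∷ xs)
    ∎

pair₂≡columnSum : ∀ a b → pair₂ a b ≡ columnSum a b
pair₂≡columnSum a b = begin
    pair₂ a b                          ≡⟨ T₂-∷-∷ a b [] ⟩
    columnSum a (b + 0) * T₂ (b ∷ [])  ≡⟨ cong₂ _*_ (cong (columnSum a) (+-identityʳ b)) T₂-[ b ] ⟩
    columnSum a b * 1                  ≡⟨ *-identityʳ _ ⟩
    columnSum a b                      ∎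

T₂≡rhsProd : ∀ ms → T₂ ms ≡ rhsProd ms
T₂≡rhsProd []           = refl
T₂≡rhsProd (m ∷ [])     = T₂-[ m ]
T₂≡rhsProd (a ∷ x ∷ xs) = begin
    T₂ (a ∷ x ∷ xs)                          ≡⟨ T₂-∷-∷ a x xs ⟩
    columnSum a (x + sum xs) * T₂ (x ∷ xs)   ≡⟨ cong₂ _*_ (sym (pair₂≡columnSum a (x + sum xs))) (T₂≡rhsProd (x ∷ xs)) ⟩
    pair₂ a (x + sum xs) * rhsProd (x ∷ xs)  ∎

-- The identity holds for every shape.
mainTheorem7 : (n : ℕ) → 2 ≤ n → (m : Vec ℕ n) →
    T₂ (toList m) ≡ rhsProd (toList m)
mainTheorem7 n _ m = T₂≡rhsProd (toList m)
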